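{- Let $G$ be a finite simple $4$-regular claw-free graph which does not contain $C_4$ as a subgraph, and let $v$ be a vertex of $G$. For an edge $xy$ of $G$, let $z(xy)$ denote the third vertex of the unique triangle of $G$ containing $xy$. Let $C$ be a hole of smallest length among the holes of $G$ containing $v$, of length $n\geq 5$. Then for every edge $xy$ of $C$, the vertex $z(xy)$ does not lie on $C$. Furthermore, if $uw\neq xy$ are two edges of $C$, then $z(uw)\neq z(xy)$.
   Context: A graph is claw-free if it does not contain $K_{1,3}$ as an induced subgraph. A triangle is a cycle of length three. A hole is a chordless cycle of length at least four; an $n$-hole is a hole of length $n$. In a $4$-regular claw-free graph with no $C_4$ subgraph, every edge lies in exactly one triangle, so $z(xy)$ is well defined. -}

module Defs where

open import Data.Nat using (ℕ; zero; suc; _∸_; _≤_)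
open import Data.Fin using (Fin; toℕ)
open import Data.Bool using (Bool; true; false; T)
open import Data.List using (List; length; filterᵇ; allFin)
open import Data.Product using (Σ; ∃; _×_; _,_)
open import Data.Sum using (_⊎_)
open import Relation.Binary.PropositionalEquality using (_≡_; _≢_)
open import Relation.Nullary using (¬_)
open import Function.Definitions using (Injective)

record Graph (N : ℕ) : Set where
  field
    adj   : Fin N → Fin N → Bool
    sym   : ∀ x y → adj x y ≡ adj y x
    irrefl : ∀ x → adj x x ≡ false
open Graph public

Adj : ∀ {N} → Graph N → Fin N → Fin N → Set
Adj G x y = adj G x y ≡ true

degree : ∀ {N} → Graph N → Fin N → ℕ
degree {N} G v = length (filterᵇ (adj G v) (allFin N))

Regular : ∀ {N} → ℕ → Graph N → Set
Regular d G = ∀ v → degree G v ≡ d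

ClawFree : ∀ {N} → Graph N → Set
ClawFree {N} G = ¬ (Σ (Fin N) λ c → Σ (Fin N) λ a → Σ (Fin N) λ b → Σ (Fin N) λ d →
  Adj G c a × Adj G c b × Adj G c d ×
  a ≢ b × a ≢ d × b ≢ d ×
  ¬ Adj G a b × ¬ Adj G a d × ¬ Adj G b d)

C4Free : ∀ {N} → Graph N → Set
C4Free {N} G = ¬ (Σ (Fin N) λ a → Σ (Fin N) λ b → Σ (Fin N) λ c → Σ (Fin N) λ d →
  a ≢ b × a ≢ c × a ≢ d × b ≢ c × b ≢ d × c ≢ d ×
  Adj G a b × Adj G b c × Adj G c d × Adj G d a)

CycSucc : (n : ℕ) → Fin n → Fin n → Set
CycSucc n i j = (toℕ j ≡ suc (toℕ i)) ⊎ (toℕ i ≡ n ∸ 1 × toℕ j ≡ 0)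

CycAdj : (n : ℕ) → Fin n → Fin n → Set
CycAdj n i j = CycSucc n i j ⊎ CycSucc n j i

record Hole {N} (G : Graph N) (n : ℕ) : Set where
  field
    len≥4 : 4 ≤ n
    vert  : Fin n → Fin N
    inj   : Injective _≡_ _≡_ vert
    cyc   : ∀ i j → CycAdj n i j → Adj G (vert i) (vert j)
    chordless : ∀ i j → i ≢ j → ¬ CycAdj n i j → ¬ Adj G (vert i) (vert j)
open Hole public

OnHole : ∀ {N} {G : Graph N} {n} → Hole G n → Fin N → Set
OnHole {n = n} C v = ∃ λ i → vert C i ≡ v

ShortestHoleThrough : ∀ {N} (G : Graph N) (v : Fin N) {n} → Hole G n → Set
ShortestHoleThrough G v {n} C =
  OnHole C v × (∀ m (D : Hole G m) → OnHole D v → n ≤ m)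

-- z is the third vertex of a triangle containing the edge xy
-- (in the setting of the lemma this triangle is unique, so z = z(xy))
IsZ : ∀ {N} → Graph N → Fin N → Fin N → Fin N → Set
IsZ G x y z = Adj G x z × Adj G y z

module Submission where

-- Let C be a shortest hole through v in a 4-regular, C4-free graph G, and read C as the
-- periodic sequence V p = vert C (p mod n), p ∈ ℕ.  Two positions give the same vertex iff
-- they agree mod n, and give adjacent vertices iff they are consecutive mod n (C is chordless);
-- so, measured from a base s, every hole vertex is V (s + t) for a unique offset t < n.
--
-- (1) An apex z of a hole edge is off the hole: a hole of length at least 4 has no triangle.
-- (2) Let z off the hole be adjacent to the ends of the edges at offsets 0 and e ≠ 0 from s.
--     If the edges are at most two steps apart (e ∈ {1, 2, n − 2, n − 1}), z closes a 4-cycle.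
--     Otherwise z has four neighbours on C and, by 4-regularity, no others, so z closes a hole
--     with each of the two arcs between the edges, both shorter than C; as v lies on one of
--     them, this contradicts the minimality of C.

open import Defs hiding (sym)
open import Data.Fin using (Fin; toℕ; fromℕ<; zero; suc)
open import Data.Fin.Properties using (toℕ-injective; toℕ<n; toℕ-fromℕ<; injective⇒≤)
import Data.Fin.Properties as Fin
open import Data.Bool using (T)
open import Data.Bool.Properties using (T?)
open import Data.Unit using (tt)
open import Data.List using (filterᵇ; allFin)
import Data.List as List
open import Data.List.Membership.Propositional using (_∈_)
open import Data.List.Membership.Propositional.Properties using (∈-filter⁺; ∈-allFin)
open import Data.List.Relation.Unary.Any using (index)
open import Data.List.Relation.Unary.Any.Properties using (lookup-index)
open import Data.Vec using (Vec; []; _∷_)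
import Data.Vec as Vec
open import Data.Vec.Relation.Unary.Linked using (Linked; [-]; _∷_)
import Data.Vec.Relation.Unary.Linked.Properties as Linked
open import Data.Vec.Relation.Unary.All using (All; []; _∷_)
import Data.Vec.Relation.Unary.All.Properties as All
open import Function.Definitions using (Injective)
open import Data.Sum using (_⊎_; inj₁; inj₂; [_,_])
import Data.Sum as Sum
open import Data.Empty using (⊥; ⊥-elim)
open import Data.Nat using (ℕ; zero; suc; _+_; _∸_; _≤_; _<_; s≤s; z≤n; NonZero; >-nonZero; >-nonZero⁻¹; _≟_; _%_; _<?_; z<s)
open import Function using (_∘_)
open import Data.Nat.Tactic.RingSolver using (solve-∀)
open import Data.Nat.Properties
open import Data.Nat.DivMod
open import Data.Product using (_,_; ∃; _×_; proj₁; proj₂)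
open import Relation.Binary.PropositionalEquality using (_≡_; _≢_; refl; sym; trans; cong; subst; subst₂; module ≡-Reasoning)
open import Relation.Binary.Definitions using (tri<; tri≈; tri>)
open import Relation.Nullary using (¬_; contradiction; yes; no)

adj-sym : ∀ {N} (G : Graph N) {x y} → Adj G x y → Adj G y x
adj-sym G {x} {y} a = trans (Graph.sym G y x) a

adj-irrefl : ∀ {N} (G : Graph N) {x} → ¬ Adj G x x
adj-irrefl G {x} a with trans (sym (irrefl G x)) a
... | ()

-- In a d-regular graph, injectively indexed neighbours of a vertex number at most d:
-- they inject into the list of its neighbours, whose length is the degree.
neighbours-bounded : ∀ {N d} (G : Graph N) → Regular d G → ∀ z {k} (w : Fin k → Fin N) →
                     (∀ i → Adj G z (w i)) → Injective _≡_ _≡_ w → k ≤ d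
neighbours-bounded {N} G reg z w z~w w-injective =
  subst (_ ≤_) (reg z) (injective⇒≤ position-injective)
  where
    neighbours = filterᵇ (adj G z) (allFin N)
    listed : ∀ i → w i ∈ neighbours
    listed i = ∈-filter⁺ (λ x → T? (adj G z x)) (∈-allFin (w i)) (subst T (sym (z~w i)) tt)
    position-injective : Injective _≡_ _≡_ (λ i → index (listed i))
    position-injective {i} {j} e = w-injective (begin
      w i                                ≡⟨ lookup-index (listed i) ⟩
      List.lookup neighbours (index (listed i)) ≡⟨ cong (List.lookup neighbours) e ⟩
      List.lookup neighbours (index (listed j)) ≡⟨ sym (lookup-index (listed j)) ⟩
      w j                                ∎)
      where open ≡-Reasoning

increasing-injective : ∀ {k} {xs : Vec ℕ k} → Linked _<_ xs → ∀ {i j} → Vec.lookup xs i ≡ Vec.lookup xs j → i ≡ j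
increasing-injective increasing {i} {j} e with Fin.<-cmp i j
... | tri< i<j _ _ = ⊥-elim (<⇒≢ (Linked.lookup⁺ <-trans increasing i<j) e)
... | tri≈ _ i≡j _ = i≡j
... | tri> _ _ j<i = ⊥-elim (<⇒≢ (Linked.lookup⁺ <-trans increasing j<i) (sym e))

module Residues (n : ℕ) {{_ : NonZero n}} where

  %-absorbˡ : ∀ a b → (a % n + b) % n ≡ (a + b) % n
  %-absorbˡ a b = begin
    (a % n + b) % n           ≡⟨ %-distribˡ-+ (a % n) b n ⟩
    (a % n % n + b % n) % n   ≡⟨ cong (λ x → (x + b % n) % n) (m%n%n≡m%n a n) ⟩
    (a % n + b % n) % n       ≡⟨ sym (%-distribˡ-+ a b n) ⟩
    (a + b) % n               ∎
    where open ≡-Reasoning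

  %-absorbʳ : ∀ a b → (a + b % n) % n ≡ (a + b) % n
  %-absorbʳ a b = begin
    (a + b % n) % n  ≡⟨ cong (_% n) (+-comm a (b % n)) ⟩
    (b % n + a) % n  ≡⟨ %-absorbˡ b a ⟩
    (b + a) % n      ≡⟨ cong (_% n) (+-comm b a) ⟩
    (a + b) % n      ∎
    where open ≡-Reasoning

  residue-moves : ∀ r k → r < n → 0 < k → k < n → (r + k) % n ≢ r
  residue-moves r k r<n 0<k k<n r+k%n≡r with r + k <? n
  ... | yes r+k<n = <⇒≢ (m<m+n r 0<k) (sym (trans (sym (m<n⇒m%n≡m r+k<n)) r+k%n≡r))
  ... | no r+k≮n with m≤n⇒∃[o]m+o≡n (≮⇒≥ r+k≮n)
  ...   | j , n+j≡r+k = <⇒≢ j<r j≡r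
    where
      j<r : j < r
      j<r = +-cancelˡ-< n j r (begin-strict
        n + j  ≡⟨ n+j≡r+k ⟩
        r + k  <⟨ +-monoʳ-< r k<n ⟩
        r + n  ≡⟨ +-comm r n ⟩
        n + r  ∎)
        where open ≤-Reasoning
      j≡r : j ≡ r
      j≡r = begin
        j              ≡⟨ sym (m<n⇒m%n≡m (<-trans j<r r<n)) ⟩
        j % n          ≡⟨ sym ([m+n]%n≡m%n j n) ⟩
        (j + n) % n    ≡⟨ cong (_% n) (trans (+-comm j n) n+j≡r+k) ⟩
        (r + k) % n    ≡⟨ r+k%n≡r ⟩
        r              ∎
        where open ≡-Reasoning

  shift-moves : ∀ y k → 0 < k → k < n → (y + k) % n ≢ y % n
  shift-moves y k 0<k k<n e =
    residue-moves (y % n) k (m%n<n y n) 0<k k<n (trans (%-absorbˡ y k) e)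

  larger-offset-moves : ∀ x {t u} → t < u → u < n → (x + u) % n ≢ (x + t) % n
  larger-offset-moves x {t} t<u u<n with m≤n⇒∃[o]m+o≡n t<u
  ... | k , refl = shift-moves (x + t) (suc k) z<s (≤-<-trans (s≤s (m≤n+m k t)) u<n)
                 ∘ subst (λ y → y % n ≡ (x + t) % n) reassociate
    where
      reassociate : x + (suc t + k) ≡ x + t + suc k
      reassociate = trans (cong (x +_) (sym (+-suc t k))) (sym (+-assoc x t (suc k)))

  offset-injective : ∀ x {t u} → t < n → u < n → (x + t) % n ≡ (x + u) % n → t ≡ u
  offset-injective x {t} {u} t<n u<n e with <-cmp t u
  ... | tri< t<u _ _ = contradiction (sym e) (larger-offset-moves x t<u u<n)
  ... | tri≈ _ t≡u _ = t≡u
  ... | tri> _ _ u<t = contradiction e (larger-offset-moves x u<t t<n)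

  offset-exists : ∀ x p → ∃ λ t → t < n × (x + t) % n ≡ p % n
  offset-exists x p = (p + (n ∸ r)) % n , m%n<n (p + (n ∸ r)) n , reach
    where
      r = x % n
      complement : r + (p + (n ∸ r)) ≡ p + n
      complement = begin
        r + (p + (n ∸ r))  ≡⟨ sym (+-assoc r p (n ∸ r)) ⟩
        r + p + (n ∸ r)    ≡⟨ cong (_+ (n ∸ r)) (+-comm r p) ⟩
        p + r + (n ∸ r)    ≡⟨ +-assoc p r (n ∸ r) ⟩
        p + (r + (n ∸ r))  ≡⟨ cong (p +_) (m+[n∸m]≡n (<⇒≤ (m%n<n x n))) ⟩
        p + n              ∎
        where open ≡-Reasoning
      reach : (x + (p + (n ∸ r)) % n) % n ≡ p % n
      reach = begin
        (x + (p + (n ∸ r)) % n) % n  ≡⟨ %-absorbʳ x (p + (n ∸ r)) ⟩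
        (x + (p + (n ∸ r))) % n      ≡⟨ sym (%-absorbˡ x (p + (n ∸ r))) ⟩
        (r + (p + (n ∸ r))) % n      ≡⟨ cong (_% n) complement ⟩
        (p + n) % n                  ≡⟨ [m+n]%n≡m%n p n ⟩
        p % n                        ∎
        where open ≡-Reasoning

regroup : ∀ s e f k → s + e + (f + k) ≡ s + k + (e + f)
regroup = solve-∀

two-past₁ : ∀ s e → s + e + 2 ≡ s + 1 + suc e
two-past₁ = solve-∀

two-past₀ : ∀ s e → s + e + 2 ≡ s + 0 + suc (suc e)
two-past₀ = solve-∀

Follows : ℕ → ℕ → ℕ → Set
Follows n t u = u ≡ suc t ⊎ (suc t ≡ n × u ≡ 0)

-- Where a second edge, at offset 0 < e < n from a first one, can sit on a cycle of length n.
data EdgeGap (n : ℕ) : ℕ → Set where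
  just-after  : EdgeGap n 1
  gap-after   : EdgeGap n 2
  just-before : ∀ {e} → suc e ≡ n → EdgeGap n e
  gap-before  : ∀ {e} → suc (suc e) ≡ n → EdgeGap n e
  far         : ∀ {e} → 3 ≤ e → e + 3 ≤ n → EdgeGap n e

edge-gap : ∀ {n e} → 0 < e → e < n → EdgeGap n e
edge-gap {e = 1} _ _ = just-after
edge-gap {e = 2} _ _ = gap-after
edge-gap {n} {e@(suc (suc (suc _)))} _ e<n with e + 3 ≤? n | m≤n⇒m<n∨m≡n e<n
... | yes e+3≤n | _         = far (s≤s (s≤s (s≤s z≤n))) e+3≤n
... | no _      | inj₂ 1+e≡n = just-before 1+e≡n
... | no e+3≰n  | inj₁ 2+e≤n = gap-before (≤-antisym 2+e≤n (≤-pred (subst (suc n ≤_) (+-comm e 3) (≰⇒> e+3≰n))))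

module CyclicIndexing {N} {G : Graph N} {n} (C : Hole G n) where

  instance
    n-nonZero : NonZero n
    n-nonZero = >-nonZero (≤-trans (s≤s z≤n) (len≥4 C))

  open Residues n

  V : ℕ → Fin N
  V p = vert C (p mod n)

  toℕ-mod : ∀ p → toℕ (p mod n) ≡ p % n
  toℕ-mod p = toℕ-fromℕ< (m%n<n p n)

  V-cong : ∀ {p q} → p % n ≡ q % n → V p ≡ V q
  V-cong {p} {q} e = cong (vert C) (toℕ-injective (trans (toℕ-mod p) (trans e (sym (toℕ-mod q)))))

  V-injective : ∀ {p q} → V p ≡ V q → p % n ≡ q % n
  V-injective {p} {q} e = trans (sym (toℕ-mod p)) (trans (cong toℕ (inj C e)) (toℕ-mod q))

  vert≡V : ∀ i → vert C i ≡ V (toℕ i)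
  vert≡V i = cong (vert C) (toℕ-injective (sym (trans (toℕ-mod (toℕ i)) (m<n⇒m%n≡m (toℕ<n i)))))

  V-suc-cong : ∀ {p q} → V p ≡ V q → V (suc p) ≡ V (suc q)
  V-suc-cong {p} {q} e = V-cong (begin
    suc p % n          ≡⟨ sym (%-absorbʳ 1 p) ⟩
    (1 + p % n) % n    ≡⟨ cong (λ r → (1 + r) % n) (V-injective e) ⟩
    (1 + q % n) % n    ≡⟨ %-absorbʳ 1 q ⟩
    suc q % n          ∎)
    where open ≡-Reasoning

  cycSucc⇒residue : ∀ {i j} → CycSucc n i j → toℕ j ≡ suc (toℕ i) % n
  cycSucc⇒residue {i} {j} (inj₁ j≡1+i) = trans j≡1+i (sym (m<n⇒m%n≡m (subst (_< n) j≡1+i (toℕ<n j))))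
  cycSucc⇒residue {i} {j} (inj₂ (i≡n-1 , j≡0)) = trans j≡0 (sym (trans (cong (λ t → suc t % n) i≡n-1) wrap))
    where
      wrap : suc (n ∸ 1) % n ≡ 0
      wrap = trans (cong (_% n) (m+[n∸m]≡n (>-nonZero⁻¹ n))) (n%n≡0 n)

  residue⇒cycSucc : ∀ {i j} → toℕ j ≡ suc (toℕ i) % n → CycSucc n i j
  residue⇒cycSucc {i} {j} e with m≤n⇒m<n∨m≡n (toℕ<n i)
  ... | inj₁ 1+i<n = inj₁ (trans e (m<n⇒m%n≡m 1+i<n))
  ... | inj₂ 1+i≡n = inj₂ (cong (_∸ 1) 1+i≡n , trans e (trans (cong (_% n) 1+i≡n) (n%n≡0 n)))

  succ-residue : ∀ p → suc (toℕ (p mod n)) % n ≡ suc p % n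
  succ-residue p = trans (cong (λ r → suc r % n) (toℕ-mod p)) (%-absorbʳ 1 p)

  V-step : ∀ p → Adj G (V p) (V (suc p))
  V-step p = cyc C (p mod n) (suc p mod n)
    (inj₁ (residue⇒cycSucc (trans (toℕ-mod (suc p)) (sym (succ-residue p)))))

  V-adjacent : ∀ p q → Adj G (V p) (V q) → q % n ≡ suc p % n ⊎ p % n ≡ suc q % n
  V-adjacent p q a with q % n ≟ suc p % n | p % n ≟ suc q % n
  ... | yes q≡p+1 | _ = inj₁ q≡p+1
  ... | no _ | yes p≡q+1 = inj₂ p≡q+1
  ... | no q≢p+1 | no p≢q+1 = ⊥-elim (chordless C (p mod n) (q mod n) distinct apart a)
    where
      distinct : p mod n ≢ q mod n
      distinct e = adj-irrefl G (subst (λ i → Adj G (V p) (vert C i)) (sym e) a)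
      residue : ∀ {p q} → CycSucc n (p mod n) (q mod n) → q % n ≡ suc p % n
      residue {p} {q} c = trans (sym (toℕ-mod q)) (trans (cycSucc⇒residue c) (succ-residue p))
      apart : ¬ CycAdj n (p mod n) (q mod n)
      apart (inj₁ c) = q≢p+1 (residue c)
      apart (inj₂ c) = p≢q+1 (residue c)

  offset-of : ∀ s p → ∃ λ t → t < n × V p ≡ V (s + t)
  offset-of s p with offset-exists s p
  ... | t , t<n , e = t , t<n , V-cong (sym e)

  offset-unique : ∀ s {t u} → t < n → u < n → V (s + t) ≡ V (s + u) → t ≡ u
  offset-unique s t<n u<n e = offset-injective s t<n u<n (V-injective e)

  offset-distinct : ∀ s {t u} → t < n → u < n → t ≢ u → V (s + t) ≢ V (s + u)
  offset-distinct s t<n u<n t≢u e = t≢u (offset-unique s t<n u<n e)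

  offset-step : ∀ s t → Adj G (V (s + t)) (V (s + suc t))
  offset-step s t = subst (λ p → Adj G (V (s + t)) (V p)) (sym (+-suc s t)) (V-step (s + t))

  offset-adjacent : ∀ s {t u} → t < n → u < n → Adj G (V (s + t)) (V (s + u)) →
                    Follows n t u ⊎ Follows n u t
  offset-adjacent s t<n u<n a = Sum.map (follows t<n u<n) (follows u<n t<n) (V-adjacent _ _ a)
    where
      follows : ∀ {t u} → t < n → u < n → (s + u) % n ≡ suc (s + t) % n → Follows n t u
      follows {t} {u} t<n u<n e with m≤n⇒m<n∨m≡n t<n
      ... | inj₁ 1+t<n = inj₁ (offset-injective s u<n 1+t<n (trans e (cong (_% n) (sym (+-suc s t)))))
      ... | inj₂ 1+t≡n = inj₂ (1+t≡n , offset-injective s u<n (>-nonZero⁻¹ n) (trans e wraps))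
        where
          wraps : suc (s + t) % n ≡ (s + 0) % n
          wraps = begin
            suc (s + t) % n  ≡⟨ cong (_% n) (trans (sym (+-suc s t)) (cong (s +_) 1+t≡n)) ⟩
            (s + n) % n      ≡⟨ [m+n]%n≡m%n s n ⟩
            s % n            ≡⟨ cong (_% n) (sym (+-identityʳ s)) ⟩
            (s + 0) % n      ∎
            where open ≡-Reasoning

  edge-offset : ∀ s {i j} → CycSucc n i j →
                ∃ λ e → e < n × vert C i ≡ V (s + e) × vert C j ≡ V (s + suc e)
  edge-offset s {i} {j} c with offset-of s (toℕ i)
  ... | e , e<n , i≡s+e = e , e<n , trans (vert≡V i) i≡s+e , (begin
    vert C j           ≡⟨ vert≡V j ⟩
    V (toℕ j)          ≡⟨ V-cong (trans (cong (_% n) (cycSucc⇒residue c)) (m%n%n≡m%n (suc (toℕ i)) n)) ⟩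
    V (suc (toℕ i))    ≡⟨ V-suc-cong i≡s+e ⟩
    V (suc (s + e))    ≡⟨ cong V (sym (+-suc s e)) ⟩
    V (s + suc e)      ∎)
    where open ≡-Reasoning

  short<n : ∀ {k} → k < 4 → k < n
  short<n k<4 = <-≤-trans k<4 (len≥4 C)

  shorter-than-hole : ∀ {k} → k < 4 → k ≢ n
  shorter-than-hole k<4 = <⇒≢ (short<n k<4)

  edge-at-base : ∀ {i j} → CycSucc n i j → vert C i ≡ V (toℕ i + 0) × vert C j ≡ V (toℕ i + 1)
  edge-at-base {i} {j} i→j with edge-offset (toℕ i) i→j
  ... | e , e<n , i≡s+e , j≡s+e+1 = start , subst (λ k → vert C j ≡ V (toℕ i + suc k)) e≡0 j≡s+e+1
    where
      start = trans (vert≡V i) (cong V (sym (+-identityʳ (toℕ i))))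
      e≡0 = offset-unique (toℕ i) e<n (short<n (s≤s z≤n)) (trans (sym i≡s+e) start)

  no-triangle : ∀ s p → Adj G (V p) (V (s + 0)) → Adj G (V p) (V (s + 1)) → ⊥
  no-triangle s p a₀ a₁ with offset-of s p
  ... | t , t<n , p≡s+t
    with offset-adjacent s t<n (short<n (s≤s z≤n)) (subst (λ x → Adj G x (V (s + 0))) p≡s+t a₀)
       | offset-adjacent s t<n (short<n (s≤s (s≤s z≤n))) (subst (λ x → Adj G x (V (s + 1))) p≡s+t a₁)
  ... | inj₁ (inj₁ ())                | _
  ... | inj₂ (inj₂ (1≡n , _))         | _ = shorter-than-hole (s≤s (s≤s z≤n)) 1≡n
  ... | _                             | inj₁ (inj₂ (_ , ()))
  ... | _                             | inj₂ (inj₂ (2≡n , _)) = shorter-than-hole (s≤s (s≤s (s≤s z≤n))) 2≡n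
  ... | inj₁ (inj₂ (1+t≡n , _))       | inj₁ (inj₁ refl) = shorter-than-hole (s≤s (s≤s z≤n)) 1+t≡n
  ... | inj₁ (inj₂ (1+t≡n , _))       | inj₂ (inj₁ refl) = shorter-than-hole (s≤s (s≤s (s≤s (s≤s z≤n)))) 1+t≡n
  ... | inj₂ (inj₁ refl)              | inj₁ (inj₁ ())
  ... | inj₂ (inj₁ refl)              | inj₂ (inj₁ ())

  -- A vertex off the hole adjacent to positions p and p + 2 closes a 4-cycle through p + 1.
  no-distance-two : C4Free G → ∀ {z} → (∀ p → z ≢ V p) →
                    ∀ p → Adj G z (V (p + 0)) → Adj G z (V (p + 2)) → ⊥
  no-distance-two c4-free {z} z∉C p z~p z~p+2 = c4-free
    ( z , V (p + 0) , V (p + 1) , V (p + 2)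
    , z∉C _ , z∉C _ , z∉C _ , apart 0<n 1<n (λ ()) , apart 0<n 2<n (λ ()) , apart 1<n 2<n (λ ())
    , z~p , offset-step p 0 , offset-step p 1 , adj-sym G z~p+2 )
    where
      apart = offset-distinct p
      0<n = short<n (s≤s z≤n)
      1<n = short<n (s≤s (s≤s z≤n))
      2<n = short<n (s≤s (s≤s (s≤s z≤n)))

  no-five-offsets : Regular 4 G → ∀ s z (os : Vec ℕ 5) → Linked _<_ os → All (_< n) os →
                    All (λ t → Adj G z (V (s + t))) os → ⊥
  no-five-offsets regular s z os increasing bounded adjacent =
    1+n≰n (neighbours-bounded G regular z (λ i → V (s + Vec.lookup os i)) (All.lookup⁺ adjacent) distinct)
    where
      distinct : Injective _≡_ _≡_ (λ i → V (s + Vec.lookup os i))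
      distinct {i} {j} e = increasing-injective increasing
        (offset-unique s (All.lookup⁺ bounded i) (All.lookup⁺ bounded j) e)

  module ArcHole (s L : ℕ) (2≤L : 2 ≤ L) (arc<n : suc L < n) {z : Fin N} (z∉C : ∀ p → z ≢ V p)
                 (z~first : Adj G z (V (s + 1))) (z~last : Adj G z (V (s + suc L)))
                 (z≁inner : ∀ t → 0 < t → t < L → ¬ Adj G z (V (s + suc t))) where

    arc : Fin (2 + L) → Fin N
    arc zero    = z
    arc (suc t) = V (s + suc (toℕ t))

    arc-offset<n : ∀ (t : Fin (suc L)) → suc (toℕ t) < n
    arc-offset<n t = ≤-<-trans (s≤s (≤-pred (toℕ<n t))) arc<n

    arc-injective : Injective _≡_ _≡_ arc
    arc-injective {zero}  {zero}  _ = refl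
    arc-injective {zero}  {suc u} e = ⊥-elim (z∉C _ e)
    arc-injective {suc t} {zero}  e = ⊥-elim (z∉C _ (sym e))
    arc-injective {suc t} {suc u} e =
      cong suc (toℕ-injective (suc-injective (offset-unique s (arc-offset<n t) (arc-offset<n u) e)))

    arc-succ-adjacent : ∀ i j → CycSucc (2 + L) i j → Adj G (arc i) (arc j)
    arc-succ-adjacent zero    zero    (inj₁ ())
    arc-succ-adjacent zero    zero    (inj₂ (() , _))
    arc-succ-adjacent zero    (suc t) (inj₁ 1+t≡1) =
      subst (λ k → Adj G z (V (s + suc k))) (sym (suc-injective 1+t≡1)) z~first
    arc-succ-adjacent zero    (suc t) (inj₂ (() , _))
    arc-succ-adjacent (suc t) zero    (inj₁ ())
    arc-succ-adjacent (suc t) zero    (inj₂ (1+t≡1+L , _)) =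
      adj-sym G (subst (λ k → Adj G z (V (s + suc k))) (sym (suc-injective 1+t≡1+L)) z~last)
    arc-succ-adjacent (suc t) (suc u) (inj₁ u≡1+t) =
      subst (λ k → Adj G (arc (suc t)) (V (s + k))) (sym u≡1+t) (offset-step s (suc (toℕ t)))
    arc-succ-adjacent (suc t) (suc u) (inj₂ (_ , ()))

    arc-cyc : ∀ i j → CycAdj (2 + L) i j → Adj G (arc i) (arc j)
    arc-cyc i j (inj₁ i→j) = arc-succ-adjacent i j i→j
    arc-cyc i j (inj₂ j→i) = adj-sym G (arc-succ-adjacent j i j→i)

    arc-chordless : ∀ i j → i ≢ j → ¬ CycAdj (2 + L) i j → ¬ Adj G (arc i) (arc j)
    arc-chordless zero    zero    i≢j _ _ = i≢j refl
    arc-chordless zero    (suc t) _   apart a = z≁inner (toℕ t) inner-start inner-end a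
      where
        inner-start : 0 < toℕ t
        inner-start = n≢0⇒n>0 (λ t≡0 → apart (inj₁ (inj₁ (cong suc t≡0))))
        inner-end : toℕ t < L
        inner-end = ≤∧≢⇒< (≤-pred (toℕ<n t)) (λ t≡L → apart (inj₂ (inj₂ (cong suc t≡L , refl))))
    arc-chordless (suc t) zero    i≢j apart a =
      arc-chordless zero (suc t) (i≢j ∘ sym) (apart ∘ Sum.swap) (adj-sym G a)
    arc-chordless (suc t) (suc u) _   apart a
      with offset-adjacent s (arc-offset<n t) (arc-offset<n u) a
    ... | inj₁ (inj₁ u-follows) = apart (inj₁ (inj₁ u-follows))
    ... | inj₁ (inj₂ (_ , ()))
    ... | inj₂ (inj₁ t-follows) = apart (inj₂ (inj₁ t-follows))
    ... | inj₂ (inj₂ (_ , ()))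

    arc-hole : Hole G (2 + L)
    arc-hole = record
      { len≥4 = s≤s (s≤s 2≤L) ; vert = arc ; inj = arc-injective
      ; cyc = arc-cyc ; chordless = arc-chordless }

    through-arc : ∀ {v} → ShortestHoleThrough G v C → ∀ t → t ≤ L → v ≡ V (s + suc t) → n ≤ 2 + L
    through-arc (_ , shortest) t t≤L v≡ = shortest (2 + L) arc-hole (suc position , on-arc)
      where
        position = fromℕ< (s≤s t≤L)
        on-arc : arc (suc position) ≡ _
        on-arc = trans (cong (λ k → V (s + suc k)) (toℕ-fromℕ< (s≤s t≤L))) (sym v≡)

  -- In a 4-regular graph these are all neighbours of z, so z closes
  -- a hole of length e + 1 < n with the arc V (s + 1), …, V (s + e); hence v is not on that arc.
  not-between : Regular 4 G → ∀ {v} → ShortestHoleThrough G v C → ∀ {z} → (∀ p → z ≢ V p) →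
                ∀ s e → 3 ≤ e → e + 3 ≤ n →
                Adj G z (V (s + 0)) → Adj G z (V (s + 1)) → Adj G z (V (s + e)) → Adj G z (V (s + suc e)) →
                ∀ t → 0 < t → t ≤ e → v ≢ V (s + t)
  not-between regular shortest {z} z∉C s (suc L) (s≤s 2≤L) e+3≤n z~0 z~1 z~e z~e+1 (suc t) _ (s≤s t≤L) v≡ =
    <⇒≱ hole-shorter (through-arc shortest t t≤L v≡)
    where
      hole-shorter : 2 + L < n
      hole-shorter = ≤-trans (n≤1+n _) (subst (_≤ n) (+-comm (suc L) 3) e+3≤n)
      last<n : suc (suc L) < n
      last<n = ≤-<-trans ≤-refl hole-shorter
      z≁inner : ∀ t → 0 < t → t < L → ¬ Adj G z (V (s + suc t))
      z≁inner t 0<t t<L z~t = no-five-offsets regular s z (0 ∷ 1 ∷ suc t ∷ suc L ∷ suc (suc L) ∷ [])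
        (z<s ∷ s≤s 0<t ∷ s≤s t<L ∷ n<1+n _ ∷ [-])
        (below z≤n ∷ below (s≤s z≤n) ∷ below (s≤s (<⇒≤ t<L)) ∷ below ≤-refl ∷ last<n ∷ [])
        (z~0 ∷ z~1 ∷ z~t ∷ z~e ∷ z~e+1 ∷ [])
        where
          below : ∀ {k} → k ≤ suc L → k < n
          below k≤1+L = ≤-<-trans k≤1+L (<-trans (n<1+n _) last<n)
      open ArcHole s L 2≤L (<-trans (n<1+n _) last<n) z∉C z~1 z~e z≁inner

  V-wrap : ∀ p → V (p + n) ≡ V p
  V-wrap p = V-cong ([m+n]%n≡m%n p n)

  around : ∀ s e f k → e + f ≡ n → V (s + e + (f + k)) ≡ V (s + k)
  around s e f k e+f≡n = trans (cong V (trans (regroup s e f k) (cong (s + k +_) e+f≡n))) (V-wrap (s + k))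

  two-arcs : ∀ s e f → e + f ≡ n → 0 < f → ∀ p →
             (∃ λ t → 0 < t × t ≤ e × V p ≡ V (s + t)) ⊎ (∃ λ t → 0 < t × t ≤ f × V p ≡ V (s + e + t))
  two-arcs s e f e+f≡n 0<f p with offset-of s p
  ... | zero , _ , p≡s+0 = inj₂ (f , 0<f , ≤-refl , trans p≡s+0 (sym full-turn))
    where
      full-turn : V (s + e + f) ≡ V (s + 0)
      full-turn = subst (λ k → V (s + e + k) ≡ V (s + 0)) (+-identityʳ f) (around s e f 0 e+f≡n)
  ... | suc t , 1+t<n , p≡s+1+t with suc t ≤? e
  ...   | yes 1+t≤e = inj₁ (suc t , z<s , 1+t≤e , p≡s+1+t)
  ...   | no 1+t≰e with m≤n⇒∃[o]m+o≡n (≰⇒> 1+t≰e)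
  ...     | k , 1+e+k≡1+t = inj₂ (suc k , z<s , <⇒≤ 1+k<f , trans p≡s+1+t (cong V position))
    where
      e+1+k≡1+t : e + suc k ≡ suc t
      e+1+k≡1+t = trans (+-suc e k) 1+e+k≡1+t
      position : s + suc t ≡ s + e + suc k
      position = trans (cong (s +_) (sym e+1+k≡1+t)) (sym (+-assoc s e (suc k)))
      1+k<f : suc k < f
      1+k<f = +-cancelˡ-< e (suc k) f (subst₂ _<_ (sym e+1+k≡1+t) (sym e+f≡n) 1+t<n)

  -- Two hole edges at offsets 0 and e from s, with 3 ≤ e and e + 3 ≤ n, have no common apex z
  -- off the hole: v lies on one of the two arcs between them, and both are excluded by
  -- not-between (the second one seen from base s + e, where the first edge sits at offset n − e).
  far-edges : Regular 4 G → ∀ {v} → ShortestHoleThrough G v C → ∀ {z} → (∀ p → z ≢ V p) →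
              ∀ s e → 3 ≤ e → e + 3 ≤ n →
              Adj G z (V (s + 0)) → Adj G z (V (s + 1)) → Adj G z (V (s + e)) → Adj G z (V (s + suc e)) → ⊥
  far-edges regular {v} shortest@((i , i≡v) , _) {z} z∉C s e 3≤e e+3≤n z~0 z~1 z~e z~e+1 =
    [ on-first-arc , on-second-arc ] (two-arcs s e f e+f≡n (≤-trans (s≤s z≤n) 3≤f) (toℕ i))
    where
      rest = m≤n⇒∃[o]m+o≡n (≤-trans (m≤m+n e 3) e+3≤n)
      f = proj₁ rest
      e+f≡n : e + f ≡ n
      e+f≡n = proj₂ rest
      3≤f : 3 ≤ f
      3≤f = +-cancelˡ-≤ e 3 f (subst (e + 3 ≤_) (sym e+f≡n) e+3≤n)
      f+3≤n : f + 3 ≤ n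
      f+3≤n = subst (f + 3 ≤_) (trans (+-comm f e) e+f≡n) (+-monoʳ-≤ f 3≤e)
      v-at : ∀ {q} → V (toℕ i) ≡ V q → v ≡ V q
      v-at i≡q = trans (sym i≡v) (trans (vert≡V i) i≡q)
      z~′ : ∀ {k m} → m ≡ k → Adj G z (V k) → Adj G z (V m)
      z~′ m≡k = subst (Adj G z ∘ V) (sym m≡k)
      z~second : ∀ k → Adj G z (V (s + k)) → Adj G z (V (s + e + (f + k)))
      z~second k = subst (Adj G z) (sym (around s e f k e+f≡n))
      on-first-arc : (∃ λ t → 0 < t × t ≤ e × V (toℕ i) ≡ V (s + t)) → ⊥
      on-first-arc (t , 0<t , t≤e , i≡) =
        not-between regular shortest z∉C s e 3≤e e+3≤n z~0 z~1 z~e z~e+1 t 0<t t≤e (v-at i≡)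
      on-second-arc : (∃ λ t → 0 < t × t ≤ f × V (toℕ i) ≡ V (s + e + t)) → ⊥
      on-second-arc (t , 0<t , t≤f , i≡) =
        not-between regular shortest z∉C (s + e) f 3≤f f+3≤n
          (z~′ (+-identityʳ (s + e)) z~e)
          (z~′ (trans (+-comm (s + e) 1) (sym (+-suc s e))) z~e+1)
          (z~′ (cong (s + e +_) (sym (+-identityʳ f))) (z~second 0 z~0))
          (z~′ (cong (s + e +_) (+-comm 1 f)) (z~second 1 z~1))
          t 0<t t≤f (v-at i≡)

  adj-around : ∀ {z} p {q} → q ≡ p + n → Adj G z (V p) → Adj G z (V q)
  adj-around {z} p q≡p+n = subst (Adj G z) (sym (trans (cong V q≡p+n) (V-wrap p)))

  -- A vertex off the hole is adjacent to the ends of at most one hole edge.  Edges at distance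
  -- at most two close a 4-cycle with it; edges further apart are handled by far-edges.
  no-shared-apex : Regular 4 G → C4Free G → ∀ {v} → ShortestHoleThrough G v C → ∀ {z} → (∀ p → z ≢ V p) →
                   ∀ s e → 0 < e → e < n →
                   Adj G z (V (s + 0)) → Adj G z (V (s + 1)) → Adj G z (V (s + e)) → Adj G z (V (s + suc e)) → ⊥
  no-shared-apex regular c4-free shortest {z} z∉C s e 0<e e<n z~0 z~1 z~e z~e+1 with edge-gap 0<e e<n
  ... | just-after        = no-distance-two c4-free z∉C s z~0 z~e+1
  ... | gap-after         = no-distance-two c4-free z∉C s z~0 z~e
  ... | just-before 1+e≡n = no-distance-two c4-free z∉C (s + e)
          (subst (Adj G z ∘ V) (sym (+-identityʳ (s + e))) z~e)
          (adj-around (s + 1) (trans (two-past₁ s e) (cong (s + 1 +_) 1+e≡n)) z~1)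
  ... | gap-before 2+e≡n  = no-distance-two c4-free z∉C (s + e)
          (subst (Adj G z ∘ V) (sym (+-identityʳ (s + e))) z~e)
          (adj-around (s + 0) (trans (two-past₀ s e) (cong (s + 0 +_) 2+e≡n)) z~0)
  ... | far 3≤e e+3≤n     = far-edges regular shortest z∉C s e 3≤e e+3≤n z~0 z~1 z~e z~e+1

lemma4 : ∀ {N} (G : Graph N) → Regular 4 G → ClawFree G → C4Free G →
    (v : Fin N) (n : ℕ) (C : Hole G n) → ShortestHoleThrough G v C → 5 ≤ n →
    (∀ i j → CycSucc n i j → ∀ z → IsZ G (vert C i) (vert C j) z → ¬ OnHole C z)
    × (∀ i j k l → CycSucc n i j → CycSucc n k l → i ≢ k →
         ∀ z z′ → IsZ G (vert C i) (vert C j) z → IsZ G (vert C k) (vert C l) z′ → z ≢ z′)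
lemma4 G regular _ c4-free v n C shortest _ = apex-off-hole , apexes-distinct
  where
    open CyclicIndexing C

    adjacent-at : ∀ {z x q} → vert C x ≡ V q → Adj G (vert C x) z → Adj G z (V q)
    adjacent-at {z} x≡q x~z = subst (Adj G z) x≡q (adj-sym G x~z)

    apex-off-hole : ∀ i j → CycSucc n i j → ∀ z → IsZ G (vert C i) (vert C j) z → ¬ OnHole C z
    apex-off-hole i j i→j z (i~z , j~z) (c , c≡z) with edge-at-base i→j
    ... | i≡ , j≡ = no-triangle (toℕ i) (toℕ c) (adjacent-at i≡ i~z′) (adjacent-at j≡ j~z′)
      where
        z≡c : z ≡ V (toℕ c)
        z≡c = trans (sym c≡z) (vert≡V c)
        i~z′ = subst (Adj G (vert C i)) z≡c i~z
        j~z′ = subst (Adj G (vert C j)) z≡c j~z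

    apexes-distinct : ∀ i j k l → CycSucc n i j → CycSucc n k l → i ≢ k →
         ∀ z z′ → IsZ G (vert C i) (vert C j) z → IsZ G (vert C k) (vert C l) z′ → z ≢ z′
    apexes-distinct i j k l i→j k→l i≢k z _ (i~z , j~z) (k~z , l~z) refl
      with edge-at-base i→j | edge-offset (toℕ i) k→l
    ... | i≡ , j≡ | e , e<n , k≡ , l≡ =
      no-shared-apex regular c4-free shortest z∉C (toℕ i) e 0<e e<n
        (adjacent-at i≡ i~z) (adjacent-at j≡ j~z) (adjacent-at k≡ k~z) (adjacent-at l≡ l~z)
      where
        z∉C : ∀ p → z ≢ V p
        z∉C p z≡p = apex-off-hole i j i→j z (i~z , j~z) (p mod n , sym z≡p)
        0<e : 0 < e
        0<e = n≢0⇒n>0 λ e≡0 → i≢k (inj C (trans i≡ (trans (cong (λ t → V (toℕ i + t)) (sym e≡0)) (sym k≡))))
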